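{- For every integer $n\ge 0$, each of the three families $\{h_{\alpha}(\mathbf{z})\}_{\alpha\vdash n}$, $\{\mathbf{C}_{\alpha}(\mathbf{z})\}_{\alpha\vdash n}$ and $\{\mathbf{K}_{\alpha}(\mathbf{z})\}_{\alpha\vdash n}$ is a $\mathbb{Q}$-basis of $\Lambda_n\otimes\mathbb{Q}$, the space of homogeneous symmetric functions of degree $n$ with rational coefficients.
   Context: A combinatorial species $F$ is a functor from the category of finite sets with bijections to the category of finite sets; its cycle index series is $Z_F=\sum_{n\ge0}\frac{1}{n!}\sum_{\sigma\in S_n}\#\mathrm{Fix}(F[\sigma])\,p_{\lambda(\sigma)}$, where $\lambda(\sigma)$ is the cycle type of $\sigma$ and $p_\lambda$ the power-sum symmetric function. For a subgroup $H\le S_n$, the molecular species $X^n/H$ is given by $(X^n/H)[U]=\{\lambda H:\lambda:[n]\to U \text{ bijection}\}$ with transport $(X^n/H)[f](\lambda H)=(f\lambda)H$; its cycle index is $\frac{1}{|H|}\sum_{\sigma\in H}p_{\lambda(\sigma)}$. For a partition $\alpha=(\alpha_1,\dots,\alpha_k)$ of $n$, the standard permutation $\sigma_\alpha\in S_n$ is the product of disjoint cycles $(1,\dots,\alpha_1)(\alpha_1+1,\dots,\alpha_1+\alpha_2)\cdots$ obtained by filling cycles of lengths $\alpha_1,\alpha_2,\dots$ with $1,\dots,n$ in increasing order. $h_\alpha(\mathbf{z})=h_{\alpha_1}\cdots h_{\alpha_k}$ is the complete homogeneous symmetric function. $\mathbf{C}_\alpha:=X^n/\langle\sigma_\alpha\rangle$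 and $\mathbf{C}_\alpha(\mathbf{z}):=Z_{\mathbf{C}_\alpha}=\frac{1}{o(\sigma_\alpha)}\sum_{g\in\langle\sigma_\alpha\rangle}p_{\lambda(g)}$, where $o(\cdot)$ denotes the order. Writing $\alpha=(i_1^{\alpha_1},\dots,i_m^{\alpha_m})$ with distinct part sizes $i_j$ occurring with multiplicities $\alpha_j$, $\mathbf{K}_\alpha(\mathbf{z}):=\mathbf{C}_{(i_1^{\alpha_1})}(\mathbf{z})\cdots\mathbf{C}_{(i_m^{\alpha_m})}(\mathbf{z})$, where $(i^{a})$ denotes the partition with $a$ parts equal to $i$. -}

module Defs where

-- Model: Λ_n ⊗ ℚ is represented in power-sum coordinates.
-- A (finite) symmetric function is a formal ℚ-linear combination of
-- power sums p_λ, given as a list of terms (coefficient , λ).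

open import Data.Nat as ℕ using (ℕ; zero; suc; _+_; _*_; _∸_; _^_; _!; _≤ᵇ_; _<ᵇ_; _≡ᵇ_)
open import Data.Integer using (+_)
open import Data.Rational as ℚ using (ℚ; 0ℚ; 1ℚ)
open import Data.Bool using (Bool; true; false; if_then_else_; _∧_; not)
open import Data.List using (List; []; _∷_; _++_; map; concat; concatMap; foldr; upTo; applyUpTo; replicate; length)
open import Data.Nat.ListAction using (sum; product)
open import Data.List.Properties using (≡-dec)
open import Data.List.Membership.Propositional using (_∈_)
open import Data.List.Relation.Unary.All using (All)
open import Data.Product using (_×_; _,_; proj₁; proj₂; ∃-syntax)
open import Relation.Nullary.Decidable using (does)
open import Relation.Binary.PropositionalEquality using (_≡_)

filterᵇ : {A : Set} → (A → Bool) → List A → List A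
filterᵇ p [] = []
filterᵇ p (x ∷ xs) = if p x then x ∷ filterᵇ p xs else filterᵇ p xs

allᵇ : {A : Set} → (A → Bool) → List A → Bool
allᵇ p [] = true
allᵇ p (x ∷ xs) = p x ∧ allᵇ p xs

-- first element of the list satisfying p (0 if none)
firstᵇ : (ℕ → Bool) → List ℕ → ℕ
firstᵇ p [] = 0
firstᵇ p (x ∷ xs) = if p x then x else firstᵇ p xs

insertDesc : ℕ → List ℕ → List ℕ
insertDesc x [] = x ∷ []
insertDesc x (y ∷ ys) = if y ≤ᵇ x then x ∷ y ∷ ys else y ∷ insertDesc x ys

sortDesc : List ℕ → List ℕ
sortDesc = foldr insertDesc []

_==ᴸ_ : List ℕ → List ℕ → Bool
xs ==ᴸ ys = does (≡-dec ℕ._≟_ xs ys)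

mult : ℕ → List ℕ → ℕ
mult i λ′ = length (filterᵇ (i ≡ᵇ_) λ′)

-- partitions of n with all parts ≤ m (fuel ≥ n ensures termination)
partsBounded : (fuel n m : ℕ) → List (List ℕ)
partsBounded _ zero _ = [] ∷ []
partsBounded zero (suc _) _ = []
partsBounded (suc f) (suc n) m =
  concatMap (λ k → map (k ∷_) (partsBounded f (suc n ∸ k) k))
            (applyUpTo suc (ℕ._⊓_ m (suc n)))

partitions : ℕ → List (List ℕ)
partitions n = partsBounded n n n

SymF : Set
SymF = List (ℚ × List ℕ)

p : List ℕ → SymF
p λ′ = (1ℚ , λ′) ∷ []

scale : ℚ → SymF → SymF
scale q = map (λ t → (q ℚ.* proj₁ t , proj₂ t))

sumS : List SymF → SymF
sumS = concat

-- product, using p_λ p_μ = p_{λ ∪ μ}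
_⊗_ : SymF → SymF → SymF
f ⊗ g = concatMap (λ s → map (λ t → (proj₁ s ℚ.* proj₁ t , proj₂ s ++ proj₂ t)) g) f

oneS : SymF
oneS = p []

prodS : List SymF → SymF
prodS = foldr _⊗_ oneS

sumℚ : List ℚ → ℚ
sumℚ = foldr ℚ._+_ 0ℚ

-- coefficient of p_λ (λ a partition, i.e. weakly decreasing)
coeff : SymF → List ℕ → ℚ
coeff f λ′ = sumℚ (map proj₁ (filterᵇ (λ t → sortDesc (proj₂ t) ==ᴸ λ′) f))

-- 1/d as a rational (d = 0 never occurs below)
inv : ℕ → ℚ
inv zero = 0ℚ
inv (suc d) = (+ 1) ℚ./ suc d

zee : List ℕ → ℕ
zee λ′ = product (map (λ i → (i ^ mult i λ′) * (mult i λ′) !) (applyUpTo suc (sum λ′)))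

h : ℕ → SymF
h k = sumS (map (λ λ′ → scale (inv (zee λ′)) (p λ′)) (partitions k))

hα : List ℕ → SymF
hα α = prodS (map h α)

-- Permutations of {0,…,n-1} (0-indexed version of [n]) as functions ℕ → ℕ

iter : (ℕ → ℕ) → ℕ → ℕ → ℕ
iter g zero x = x
iter g (suc k) x = g (iter g k x)

-- standard permutation σ_α: cycles (s, s+1, …, s+a-1) filled in increasing order
sigmaFrom : ℕ → List ℕ → ℕ → ℕ
sigmaFrom s [] x = x
sigmaFrom s (a ∷ α) x =
  if (s ≤ᵇ x) ∧ (x <ᵇ s + a)
  then (if suc x <ᵇ s + a then suc x else s)
  else sigmaFrom (s + a) α x

sigma : List ℕ → ℕ → ℕ
sigma = sigmaFrom 0

orbitLen : (ℕ → ℕ) → ℕ → ℕ → ℕ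
orbitLen g n x = firstᵇ (λ k → iter g k x ≡ᵇ x) (applyUpTo suc n)

isCycleMin : (ℕ → ℕ) → ℕ → ℕ → Bool
isCycleMin g n x = allᵇ (λ j → x ≤ᵇ iter g j x) (upTo n)

cycleType : (ℕ → ℕ) → ℕ → List ℕ
cycleType g n = sortDesc (map (orbitLen g n) (filterᵇ (isCycleMin g n) (upTo n)))

-- order o(g): least k ≥ 1 with g^k = id on {0,…,n-1} (o(g) ≤ n!)
order : (ℕ → ℕ) → ℕ → ℕ
order g n = firstᵇ (λ k → allᵇ (λ x → iter g k x ≡ᵇ x) (upTo n)) (applyUpTo suc (n !))

-- C_α(z) = (1/o(σ_α)) Σ_{g ∈ ⟨σ_α⟩} p_{λ(g)},  ⟨σ_α⟩ = {σ_α^k : 0 ≤ k < o(σ_α)}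

C : List ℕ → SymF
C α = scale (inv o) (sumS (map (λ k → p (cycleType (iter g k) n)) (upTo o)))
  where
  n = sum α
  g = sigma α
  o = order g n

K : List ℕ → SymF
K α = prodS (map (λ i → C (replicate (mult i α) i))
                 (filterᵇ (λ i → not (mult i α ≡ᵇ 0)) (applyUpTo suc (sum α))))

lincomb : ℕ → (List ℕ → ℚ) → (List ℕ → SymF) → SymF
lincomb n c B = sumS (map (λ α → scale (c α) (B α)) (partitions n))

record IsBasisΛ (n : ℕ) (B : List ℕ → SymF) : Set where
  field
    inDegree : ∀ α → α ∈ partitions n → All (λ t → sortDesc (proj₂ t) ∈ partitions n) (B α)
    spans : ∀ (v : List ℕ → ℚ) → ∃[ c ] (∀ λ′ → λ′ ∈ partitions n → coeff (lincomb n c B) λ′ ≡ v λ′)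
    indep : ∀ (c : List ℕ → ℚ) → (∀ λ′ → λ′ ∈ partitions n → coeff (lincomb n c B) λ′ ≡ 0ℚ)
            → ∀ α → α ∈ partitions n → c α ≡ 0ℚ

-- Each of the three families is triangular with respect to the power sums, ordered by the
-- number of parts: B_α is a positive combination of power sums p_λ with λ a refinement of α,
-- and p_α itself occurs.  For h_α this comes from h_a = Σ_{λ ⊢ a} p_λ / z_λ.  For C_α it comes
-- from the cycle types of the powers of σ_α: on each cycle of length a, σ_α^k splits into
-- gcd(k, a) cycles of length a / gcd(k, a), and σ_α itself has cycle type α.  K_α is a product
-- of such C's, hence again triangular, with leading term the product of the p_{(i^m)}, i.e. p_α.
-- A proper refinement has strictly more parts, so the matrix of p_λ-coefficients of the B_α is
-- triangular with positive diagonal, hence invertible.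

module Submission where

open import Defs
open import Function using (id; _∘_; _⇔_; mk⇔; Equivalence)
open import Data.Bool using (Bool; true; false; T; not; _∧_; if_then_else_)
open import Data.Bool.ListAction using (all)
open import Data.Unit using (tt)
open import Data.Product using (_×_; _,_; proj₁; proj₂; map₁; ∃-syntax)
open import Data.Sum using (_⊎_; inj₁; inj₂)
open import Data.Nat
  using (ℕ; zero; suc; pred; _+_; _*_; _∸_; _^_; _!; _%_; _/_; _⊓_; _≤_; _<_; z≤n; s≤s; z<s;
         _≤ᵇ_; _<ᵇ_; _≡ᵇ_; _≟_; NonZero; ≢-nonZero; >-nonZero; >-nonZero⁻¹)
open import Data.Nat.Properties
open import Data.Nat.DivMod
open import Data.Nat.Divisibility
open import Data.Nat.GCD
  using (gcd; gcd[m,n]∣m; gcd[m,n]∣n; gcd[m,n]≢0; gcd-GCD; gcd-zeroˡ; gcd-identityˡ; module Bézout)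
open import Data.Nat.Coprimality as Coprimality using (Coprime; coprime-/gcd; coprime-divisor)
open import Data.Nat.Solver using (module +-*-Solver)
open import Data.Nat.ListAction using (sum)
open import Data.Nat.ListAction.Properties using (sum-++; sum-↭; product≢0)
open import Data.Rational as ℚ using (ℚ; 0ℚ; 1ℚ; Positive; NonNegative)
import Data.Rational.Properties as ℚ
import Data.Rational.Solver
open import Algebra.Bundles using (CommutativeMonoid)
open import Algebra.Properties.CommutativeSemigroup
  (CommutativeMonoid.commutativeSemigroup ℚ.+-0-commutativeMonoid) using (interchange)
open import Data.List using (List; []; _∷_; [_]; _++_; map; filter; concatMap; applyUpTo; upTo; replicate; length)
open import Data.List.Properties
  using (≡-dec; ++-assoc; ++-identityʳ; map-++; map-cong; map-cong-local; length-++; length-applyUpTo;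
         length-replicate; concatMap-++; concatMap-pure; applyUpTo-∷ʳ; filter-all; filter-none)
open import Data.List.Membership.Propositional using (_∈_; find; lose)
open import Data.List.Membership.Propositional.Properties
  using (∈-∃++; ∈-map⁺; ∈-map⁻; ∈-concatMap⁺; ∈-concatMap⁻; ∈-applyUpTo⁺; ∈-applyUpTo⁻)
open import Data.List.Relation.Unary.All using (All; []; _∷_)
import Data.List.Relation.Unary.All as All
import Data.List.Relation.Unary.All.Properties as All
open import Data.List.Relation.Unary.Any using (Any; here; there)
import Data.List.Relation.Unary.Any as Any
import Data.List.Relation.Unary.Any.Properties as Any
open import Data.List.Relation.Unary.AllPairs using (_∷_)
open import Data.List.Relation.Unary.Linked using ([]; [-]; _∷_)
import Data.List.Relation.Unary.Linked as Linked
open import Data.List.Relation.Binary.Permutation.Propositional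
  using (_↭_; ↭-refl; ↭-prep; ↭-sym; ↭-trans; ↭-reflexive; ↭⇒↭ₛ′; module PermutationReasoning)
open import Data.List.Relation.Binary.Permutation.Propositional.Properties using (shift; All-resp-↭; ↭-length; ++⁺)
import Data.List.Relation.Binary.Pointwise as Pointwise
open import Data.List.Sort.InsertionSort.Base using (insert; sort)
import Data.List.Sort.InsertionSort.Properties as InsertionSort
open import Relation.Binary.Bundles using (DecTotalOrder)
open import Relation.Binary.Definitions using (DecidableEquality)
open import Relation.Binary.Properties.DecTotalOrder ≤-decTotalOrder using (≥-decTotalOrder; ≥-totalOrder)
open import Data.List.Relation.Unary.Sorted.TotalOrder ≥-totalOrder using (Sorted)
open import Data.List.Relation.Unary.Sorted.TotalOrder.Properties using (↗↭↗⇒≋; Sorted⇒AllPairs)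
open import Relation.Nullary using (¬_; yes; no; does; contradiction)
open import Relation.Nullary.Decidable using (T?)
open import Relation.Nullary.Reflects using (Reflects; ofʸ; ofⁿ; fromEquivalence)
open import Relation.Binary.PropositionalEquality hiding ([_])

≡ᵇ-reflects-≡ : ∀ m n → Reflects (m ≡ n) (m ≡ᵇ n)
≡ᵇ-reflects-≡ m n = fromEquivalence (≡ᵇ⇒≡ m n) (≡⇒≡ᵇ m n)

applyUpTo-++ : ∀ {A : Set} (f : ℕ → A) m n → applyUpTo f (m + n) ≡ applyUpTo f m ++ applyUpTo (f ∘ (m +_)) n
applyUpTo-++ f zero n = refl
applyUpTo-++ f (suc m) n = cong (f 0 ∷_) (applyUpTo-++ (f ∘ suc) m n)

applyUpTo-cong : ∀ {A : Set} {f g : ℕ → A} → (∀ i → f i ≡ g i) → ∀ n → applyUpTo f n ≡ applyUpTo g n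
applyUpTo-cong f≗g zero = refl
applyUpTo-cong f≗g (suc n) = cong₂ _∷_ (f≗g 0) (applyUpTo-cong (f≗g ∘ suc) n)

filterᵇ≗filter : ∀ {A : Set} (p : A → Bool) xs → filterᵇ p xs ≡ filter (T? ∘ p) xs
filterᵇ≗filter p [] = refl
filterᵇ≗filter p (x ∷ xs) with p x
... | true = cong (x ∷_) (filterᵇ≗filter p xs)
... | false = filterᵇ≗filter p xs

filterᵇ-++ : ∀ {A : Set} (p : A → Bool) xs ys → filterᵇ p (xs ++ ys) ≡ filterᵇ p xs ++ filterᵇ p ys
filterᵇ-++ p [] ys = refl
filterᵇ-++ p (x ∷ xs) ys with p x
... | true = cong (x ∷_) (filterᵇ-++ p xs ys)
... | false = filterᵇ-++ p xs ys

filterᵇ-applyUpTo-prefix : ∀ (p : ℕ → Bool) f {n m} → m ≤ n →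
  (∀ {i} → i < m → T (p (f i))) → (∀ {i} → m ≤ i → i < n → ¬ T (p (f i))) →
  filterᵇ p (applyUpTo f n) ≡ applyUpTo f m
filterᵇ-applyUpTo-prefix p f {n} {m} m≤n kept dropped = begin
  filterᵇ p (applyUpTo f n)
    ≡⟨ cong (filterᵇ p) (trans (cong (applyUpTo f) (sym (m+[n∸m]≡n m≤n))) (applyUpTo-++ f m (n ∸ m))) ⟩
  filterᵇ p (applyUpTo f m ++ applyUpTo (f ∘ (m +_)) (n ∸ m))
    ≡⟨ filterᵇ-++ p (applyUpTo f m) _ ⟩
  filterᵇ p (applyUpTo f m) ++ filterᵇ p (applyUpTo (f ∘ (m +_)) (n ∸ m))
    ≡⟨ cong₂ _++_ (trans (filterᵇ≗filter p (applyUpTo f m)) (filter-all (T? ∘ p) (All.applyUpTo⁺₁ f m kept)))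
                  (trans (filterᵇ≗filter p rest) (filter-none (T? ∘ p) (All.applyUpTo⁺₁ (f ∘ (m +_)) (n ∸ m) dropped′))) ⟩
  applyUpTo f m ++ []
    ≡⟨ ++-identityʳ _ ⟩
  applyUpTo f m ∎
  where
  open ≡-Reasoning
  rest : List ℕ
  rest = applyUpTo (f ∘ (m +_)) (n ∸ m)
  dropped′ : ∀ {i} → i < n ∸ m → ¬ T (p (f (m + i)))
  dropped′ {i} i<n∸m = dropped (m≤m+n m i) (subst (m + i <_) (m+[n∸m]≡n m≤n) (+-monoʳ-< m i<n∸m))

concatMap-filterᵇ : ∀ {A B : Set} (p : A → Bool) (G : A → List B) xs → (∀ x → p x ≡ false → G x ≡ []) →
                    concatMap G (filterᵇ p xs) ≡ concatMap G xs
concatMap-filterᵇ p G [] _ = refl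
concatMap-filterᵇ p G (x ∷ xs) dropped with p x in eq
... | true = cong (G x ++_) (concatMap-filterᵇ p G xs dropped)
... | false rewrite dropped x eq = concatMap-filterᵇ p G xs dropped

allᵇ≗all : ∀ {A : Set} (p : A → Bool) xs → allᵇ p xs ≡ all p xs
allᵇ≗all p [] = refl
allᵇ≗all p (x ∷ xs) = cong (p x ∧_) (allᵇ≗all p xs)

T-allᵇ : ∀ {A : Set} (p : A → Bool) xs → T (allᵇ p xs) ⇔ All (T ∘ p) xs
T-allᵇ p xs = mk⇔ (All.all⁺ p xs ∘ subst T (allᵇ≗all p xs)) (subst T (sym (allᵇ≗all p xs)) ∘ All.all⁻ p)

firstᵇ-found : ∀ (p : ℕ → Bool) {xs} → Any (T ∘ p) xs → firstᵇ p xs ∈ xs × T (p (firstᵇ p xs))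
firstᵇ-found p {x ∷ xs} px∈ with p x in eq | px∈
... | true | _ = here refl , subst T (sym eq) tt
... | false | here px = contradiction (subst T eq px) (λ ())
... | false | there px∈′ = map₁ there (firstᵇ-found p px∈′)

firstᵇ-applyUpTo : ∀ (p : ℕ → Bool) f {m n} → (∀ i → i < m → ¬ T (p (f i))) → T (p (f m)) → m < n →
                   firstᵇ p (applyUpTo f n) ≡ f m
firstᵇ-applyUpTo p f {zero} {suc n} _ pfm _ with p (f 0) | pfm
... | true | _ = refl
... | false | ()
firstᵇ-applyUpTo p f {suc m} {suc n} earlier pfm (s≤s m<n) with p (f 0) | earlier 0 z<s
... | true | ¬pf0 = contradiction tt ¬pf0
... | false | _ = firstᵇ-applyUpTo p (f ∘ suc) (λ i i<m → earlier (suc i) (s≤s i<m)) pfm m<n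

map-constant : ∀ {A B : Set} (h : A → B) {c xs} → All (λ x → h x ≡ c) xs → map h xs ≡ replicate (length xs) c
map-constant h [] = refl
map-constant h (hx≡c ∷ rest) = cong₂ _∷_ hx≡c (map-constant h rest)

sum-replicate : ∀ n x → sum (replicate n x) ≡ n * x
sum-replicate zero x = refl
sum-replicate (suc n) x = cong (x +_) (sum-replicate n x)

parts≤sum : ∀ xs → All (_≤ sum xs) xs
parts≤sum [] = []
parts≤sum (x ∷ xs) = m≤m+n x (sum xs) ∷ All.map (λ x≤ → ≤-trans x≤ (m≤n+m (sum xs) x)) (parts≤sum xs)

iter-+ : ∀ (g : ℕ → ℕ) m n x → iter g (m + n) x ≡ iter g m (iter g n x)
iter-+ g zero n x = refl
iter-+ g (suc m) n x = cong g (iter-+ g m n x)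

iter-iter : ∀ (g : ℕ → ℕ) k j x → iter (iter g k) j x ≡ iter g (j * k) x
iter-iter g k zero x = refl
iter-iter g k (suc j) x = trans (cong (iter g k) (iter-iter g k j x)) (sym (iter-+ g k (j * k) x))

insertDesc≡insert : ∀ x xs → insertDesc x xs ≡ insert ≥-decTotalOrder x xs
insertDesc≡insert x [] = refl
insertDesc≡insert x (y ∷ ys) with y ≤ᵇ x
... | true = refl
... | false = cong (y ∷_) (insertDesc≡insert x ys)

sortDesc≡sort : ∀ xs → sortDesc xs ≡ sort ≥-decTotalOrder xs
sortDesc≡sort [] = refl
sortDesc≡sort (x ∷ xs) rewrite sortDesc≡sort xs = insertDesc≡insert x (sort ≥-decTotalOrder xs)

sortDesc-↭ : ∀ xs → sortDesc xs ↭ xs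
sortDesc-↭ xs rewrite sortDesc≡sort xs = InsertionSort.sort-↭ ≥-decTotalOrder xs

sortDesc-sorted : ∀ xs → Sorted (sortDesc xs)
sortDesc-sorted xs rewrite sortDesc≡sort xs = InsertionSort.sort-↗ ≥-decTotalOrder xs

sorted-↭⇒≡ : ∀ {xs ys} → Sorted xs → Sorted ys → xs ↭ ys → xs ≡ ys
sorted-↭⇒≡ xs↘ ys↘ xs↭ys = Pointwise.Pointwise-≡⇒≡
  (↗↭↗⇒≋ ≥-totalOrder xs↘ ys↘ (↭⇒↭ₛ′ (DecTotalOrder.Eq.isEquivalence ≥-decTotalOrder) xs↭ys))

sorted-∷ : ∀ {x xs} → All (_≤ x) xs → Sorted xs → Sorted (x ∷ xs)
sorted-∷ [] _ = [-]
sorted-∷ (y≤x ∷ _) xs↘ = y≤x ∷ xs↘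

sorted-head : ∀ {x xs} → Sorted (x ∷ xs) → All (_≤ x) xs
sorted-head x∷xs↘ with x≥xs ∷ _ ← Sorted⇒AllPairs ≥-totalOrder x∷xs↘ = x≥xs

mult-++ : ∀ i xs ys → mult i (xs ++ ys) ≡ mult i xs + mult i ys
mult-++ i [] ys = refl
mult-++ i (x ∷ xs) ys with i ≡ᵇ x
... | true = cong suc (mult-++ i xs ys)
... | false = mult-++ i xs ys

mult-here : ∀ x xs → mult x (x ∷ xs) ≡ suc (mult x xs)
mult-here x xs with x ≡ᵇ x | ≡ᵇ-reflects-≡ x x
... | true | _ = refl
... | false | ofⁿ x≢x = contradiction refl x≢x

mult-there : ∀ {i x} xs → i ≢ x → mult i (x ∷ xs) ≡ mult i xs
mult-there {i} {x} xs i≢x with i ≡ᵇ x | ≡ᵇ-reflects-≡ i x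
... | true | ofʸ i≡x = contradiction i≡x i≢x
... | false | _ = refl

mult-replicate-self : ∀ m i → mult i (replicate m i) ≡ m
mult-replicate-self zero i = refl
mult-replicate-self (suc m) i = trans (mult-here i (replicate m i)) (cong suc (mult-replicate-self m i))

mult-replicate-other : ∀ m {i j} → j ≢ i → mult j (replicate m i) ≡ 0
mult-replicate-other zero j≢i = refl
mult-replicate-other (suc m) {i} j≢i = trans (mult-there (replicate m i) j≢i) (mult-replicate-other m j≢i)

mult>0⇒∈ : ∀ i xs → 0 < mult i xs → i ∈ xs
mult>0⇒∈ i (x ∷ xs) 0<mult with i ≟ x
... | yes refl = here refl
... | no i≢x rewrite mult-there xs i≢x = there (mult>0⇒∈ i xs 0<mult)

mult-absent : ∀ {i xs} → ¬ i ∈ xs → mult i xs ≡ 0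
mult-absent {i} {xs} i∉xs with mult i xs in eq
... | zero = refl
... | suc _ = contradiction (mult>0⇒∈ i xs (subst (0 <_) (sym eq) z<s)) i∉xs

mult-middle : ∀ i us xs vs → mult i (us ++ xs ++ vs) ≡ mult i xs + mult i (us ++ vs)
mult-middle i us xs vs = begin
  mult i (us ++ xs ++ vs)              ≡⟨ mult-++ i us (xs ++ vs) ⟩
  mult i us + mult i (xs ++ vs)        ≡⟨ cong (mult i us +_) (mult-++ i xs vs) ⟩
  mult i us + (mult i xs + mult i vs)  ≡⟨ sym (+-assoc (mult i us) _ _) ⟩
  mult i us + mult i xs + mult i vs    ≡⟨ cong (_+ mult i vs) (+-comm (mult i us) _) ⟩
  mult i xs + mult i us + mult i vs    ≡⟨ +-assoc (mult i xs) _ _ ⟩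
  mult i xs + (mult i us + mult i vs)  ≡⟨ cong (mult i xs +_) (sym (mult-++ i us vs)) ⟩
  mult i xs + mult i (us ++ vs)        ∎
  where open ≡-Reasoning

mult-≡⇒↭ : ∀ xs {ys} → (∀ i → mult i xs ≡ mult i ys) → xs ↭ ys
mult-≡⇒↭ [] {[]} _ = ↭-refl
mult-≡⇒↭ [] {y ∷ ys} same = contradiction (trans (same y) (mult-here y ys)) 0≢1+n
mult-≡⇒↭ (x ∷ xs) {ys} same
  with us , vs , refl ← ∈-∃++ (mult>0⇒∈ x ys (subst (0 <_) (trans (sym (mult-here x xs)) (same x)) (s≤s z≤n))) = begin
    x ∷ xs             ↭⟨ ↭-prep x (mult-≡⇒↭ xs same′) ⟩
    x ∷ us ++ vs       ↭⟨ ↭-sym (shift x us vs) ⟩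
    us ++ [ x ] ++ vs  ∎
  where
  open PermutationReasoning
  same′ : ∀ i → mult i xs ≡ mult i (us ++ vs)
  same′ i = +-cancelˡ-≡ (mult i [ x ]) _ _
    (trans (sym (mult-++ i [ x ] xs)) (trans (same i) (mult-middle i us [ x ] vs)))

record IsPartition (n : ℕ) (α : List ℕ) : Set where
  constructor mkPartition
  field
    sorted   : Sorted α
    positive : All (1 ≤_) α
    sum≡     : sum α ≡ n

partsBounded-sound : ∀ f n m {α} → α ∈ partsBounded f n m → IsPartition n α × All (_≤ m) α
partsBounded-sound f zero m (here refl) = mkPartition [] [] refl , []
partsBounded-sound (suc f) (suc n) m α∈
  with k , k∈ , α∈ ← find (∈-concatMap⁻ (λ k → map (k ∷_) (partsBounded f (suc n ∸ k) k))
                                      {xs = applyUpTo suc (m ⊓ suc n)} α∈)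
  with i , i<m⊓n , refl ← ∈-applyUpTo⁻ suc k∈
  with β , β∈ , refl ← ∈-map⁻ (suc i ∷_) α∈
  with mkPartition β↘ β>0 sumβ , β≤ ← partsBounded-sound f (suc n ∸ suc i) (suc i) β∈
  = mkPartition (sorted-∷ β≤ β↘) (s≤s z≤n ∷ β>0) (trans (cong (suc i +_) sumβ) (m+[n∸m]≡n i<n)) ,
    (i<m ∷ All.map (λ p≤ → ≤-trans p≤ i<m) β≤)
  where
  i<m : suc i ≤ m
  i<m = ≤-trans i<m⊓n (m⊓n≤m m (suc n))
  i<n : suc i ≤ suc n
  i<n = ≤-trans i<m⊓n (m⊓n≤n m (suc n))

partsBounded-complete : ∀ f n m {α} → n ≤ f → IsPartition n α → All (_≤ m) α → α ∈ partsBounded f n m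
partsBounded-complete f zero m {[]} _ _ _ = here refl
partsBounded-complete f zero m {_ ∷ _} _ (mkPartition _ (s≤s _ ∷ _) ()) _
partsBounded-complete (suc f) (suc n) m {suc i ∷ β} (s≤s n≤f) (mkPartition α↘ (_ ∷ β>0) refl) (k≤m ∷ _) =
  ∈-concatMap⁺ (λ k → map (k ∷_) (partsBounded f (suc n ∸ k) k)) {xs = applyUpTo suc (m ⊓ suc n)}
    (lose (∈-applyUpTo⁺ suc (⊓-glb k≤m k≤n)) (∈-map⁺ (suc i ∷_) β∈))
  where
  k≤n : suc i ≤ suc n
  k≤n = m≤m+n (suc i) (sum β)
  β∈ : β ∈ partsBounded f (suc n ∸ suc i) (suc i)
  β∈ = partsBounded-complete f (suc n ∸ suc i) (suc i) (≤-trans (m∸n≤m n i) n≤f)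
         (mkPartition (Linked.tail α↘) β>0 (sym (m+n∸m≡n (suc i) (sum β))))
         (sorted-head α↘)

partitions-sound : ∀ {n α} → α ∈ partitions n → IsPartition n α
partitions-sound {n} α∈ = proj₁ (partsBounded-sound n n n α∈)

partitions-complete : ∀ {n α} → IsPartition n α → α ∈ partitions n
partitions-complete {n} {α} α⊢n@(mkPartition _ _ refl) = partsBounded-complete n n n ≤-refl α⊢n (parts≤sum α)

module _ {A : Set} where

  sumℚ-map-+ : ∀ (f g : A → ℚ) xs → sumℚ (map (λ a → f a ℚ.+ g a) xs) ≡ sumℚ (map f xs) ℚ.+ sumℚ (map g xs)
  sumℚ-map-+ f g [] = sym (ℚ.+-identityˡ 0ℚ)
  sumℚ-map-+ f g (x ∷ xs) =
    trans (cong (f x ℚ.+ g x ℚ.+_) (sumℚ-map-+ f g xs)) (interchange (f x) (g x) _ _)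

  sumℚ-map-*ʳ : ∀ (f : A → ℚ) k xs → sumℚ (map (λ a → f a ℚ.* k) xs) ≡ sumℚ (map f xs) ℚ.* k
  sumℚ-map-*ʳ f k [] = sym (ℚ.*-zeroˡ k)
  sumℚ-map-*ʳ f k (x ∷ xs) = trans (cong (f x ℚ.* k ℚ.+_) (sumℚ-map-*ʳ f k xs)) (sym (ℚ.*-distribʳ-+ k (f x) _))

  sumℚ-map-0 : ∀ (f : A → ℚ) {xs} → All (λ a → f a ≡ 0ℚ) xs → sumℚ (map f xs) ≡ 0ℚ
  sumℚ-map-0 f [] = refl
  sumℚ-map-0 f (fx≡0 ∷ fxs≡0) rewrite fx≡0 | sumℚ-map-0 f fxs≡0 = refl

sumℚ-nonNeg : ∀ {qs} → All NonNegative qs → NonNegative (sumℚ qs)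
sumℚ-nonNeg [] = _
sumℚ-nonNeg {q ∷ qs} (q≥0 ∷ qs≥0) = ℚ.nonNeg+nonNeg⇒nonNeg q {{q≥0}} (sumℚ qs) {{sumℚ-nonNeg qs≥0}}

sumℚ-pos : ∀ {qs} → All NonNegative qs → Any Positive qs → Positive (sumℚ qs)
sumℚ-pos {q ∷ qs} (_ ∷ qs≥0) (here q>0) = ℚ.pos+nonNeg⇒pos q {{q>0}} (sumℚ qs) {{sumℚ-nonNeg qs≥0}}
sumℚ-pos {q ∷ qs} (q≥0 ∷ qs≥0) (there qs>0) = ℚ.nonNeg+pos⇒pos q {{q≥0}} (sumℚ qs) {{sumℚ-pos qs≥0 qs>0}}

pos⇒≢0 : ∀ {q} → Positive q → q ≢ 0ℚ
pos⇒≢0 {q} q>0 q≡0 = ℚ.<⇒≢ (ℚ.positive⁻¹ q {{q>0}}) (sym q≡0)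

-- Total, with recip 0ℚ = 0ℚ.
recip : ℚ → ℚ
recip q with q ℚ.≟ 0ℚ
... | yes _ = 0ℚ
... | no q≢0 = ℚ.1/_ q {{ℚ.≢-nonZero q≢0}}

*-recip : ∀ q → q ≢ 0ℚ → q ℚ.* recip q ≡ 1ℚ
*-recip q q≢0 with q ℚ.≟ 0ℚ
... | yes q≡0 = contradiction q≡0 q≢0
... | no q≢0 = ℚ.*-inverseʳ q {{ℚ.≢-nonZero q≢0}}

*≡0⇒≡0 : ∀ p q → p ℚ.* q ≡ 0ℚ → p ≢ 0ℚ → q ≡ 0ℚ
*≡0⇒≡0 p q pq≡0 p≢0 = begin
  q                        ≡⟨ sym (ℚ.*-identityˡ q) ⟩
  1ℚ ℚ.* q                 ≡⟨ cong (ℚ._* q) (sym (trans (ℚ.*-comm (recip p) p) (*-recip p p≢0))) ⟩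
  recip p ℚ.* p ℚ.* q      ≡⟨ ℚ.*-assoc (recip p) p q ⟩
  recip p ℚ.* (p ℚ.* q)    ≡⟨ cong (recip p ℚ.*_) pq≡0 ⟩
  recip p ℚ.* 0ℚ           ≡⟨ ℚ.*-zeroʳ (recip p) ⟩
  0ℚ                       ∎
  where open ≡-Reasoning

-- L need not be duplicate-free.
module TriangularSystem {I : Set} (_≟ᵢ_ : DecidableEquality I) (rank : I → ℕ) (L : List I) (M : I → I → ℚ)
  (M-lower : ∀ {λ′ α} → α ∈ L → λ′ ≢ α → rank λ′ ≤ rank α → M λ′ α ≡ 0ℚ)
  (M-diagonal : ∀ {α} → α ∈ L → M α α ≢ 0ℚ)
  where

  combination : (I → ℚ) → I → ℚ
  combination c λ′ = sumℚ (map (λ α → c α ℚ.* M λ′ α) L)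

  δ : I → I → ℚ
  δ λ′ α = if does (α ≟ᵢ λ′) then 1ℚ else 0ℚ

  occurrences : I → ℚ
  occurrences λ′ = sumℚ (map (δ λ′) L)

  lowerTerm : (I → ℚ) → I → I → ℚ
  lowerTerm c λ′ α = if rank α <ᵇ rank λ′ then c α ℚ.* M λ′ α else 0ℚ

  lowerPart : (I → ℚ) → I → ℚ
  lowerPart c λ′ = sumℚ (map (lowerTerm c λ′) L)

  occurrences≢0 : ∀ {λ′} → λ′ ∈ L → occurrences λ′ ≢ 0ℚ
  occurrences≢0 {λ′} λ′∈L =
    pos⇒≢0 (sumℚ-pos (All.map⁺ (All.tabulate (λ {α} _ → δ≥0 α))) (Any.map⁺ (Any.map δ>0 λ′∈L)))
    where
    δ≥0 : ∀ α → NonNegative (δ λ′ α)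
    δ≥0 α with does (α ≟ᵢ λ′)
    ... | true = _
    ... | false = _
    δ>0 : ∀ {α} → λ′ ≡ α → Positive (δ λ′ α)
    δ>0 {α} refl with α ≟ᵢ α
    ... | yes _ = _
    ... | no α≢α = contradiction refl α≢α

  combination-split : ∀ c λ′ →
                      combination c λ′ ≡ occurrences λ′ ℚ.* (c λ′ ℚ.* M λ′ λ′) ℚ.+ lowerPart c λ′
  combination-split c λ′ = begin
    combination c λ′
      ≡⟨ cong sumℚ (map-cong-local (All.tabulate termwise)) ⟩
    sumℚ (map (λ α → δ λ′ α ℚ.* cM ℚ.+ lowerTerm c λ′ α) L)
      ≡⟨ sumℚ-map-+ _ _ L ⟩
    sumℚ (map (λ α → δ λ′ α ℚ.* cM) L) ℚ.+ lowerPart c λ′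
      ≡⟨ cong (ℚ._+ lowerPart c λ′) (sumℚ-map-*ʳ _ _ L) ⟩
    occurrences λ′ ℚ.* (c λ′ ℚ.* M λ′ λ′) ℚ.+ lowerPart c λ′ ∎
    where
    open ≡-Reasoning
    cM : ℚ
    cM = c λ′ ℚ.* M λ′ λ′
    termwise : ∀ {α} → α ∈ L → c α ℚ.* M λ′ α ≡ δ λ′ α ℚ.* cM ℚ.+ lowerTerm c λ′ α
    termwise {α} α∈L with α ≟ᵢ λ′ | rank α <ᵇ rank λ′ | <ᵇ-reflects-< (rank α) (rank λ′)
    ... | yes refl | true | ofʸ r<r = contradiction r<r (<-irrefl refl)
    ... | yes refl | false | _ = sym (trans (ℚ.+-identityʳ (1ℚ ℚ.* cM)) (ℚ.*-identityˡ cM))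
    ... | no _ | true | _ = sym (trans (cong (ℚ._+ (c α ℚ.* M λ′ α)) (ℚ.*-zeroˡ cM)) (ℚ.+-identityˡ _))
    ... | no α≢λ′ | false | ofⁿ r≮r = begin
      c α ℚ.* M λ′ α              ≡⟨ cong (c α ℚ.*_) (M-lower α∈L (α≢λ′ ∘ sym) (≮⇒≥ r≮r)) ⟩
      c α ℚ.* 0ℚ                  ≡⟨ ℚ.*-zeroʳ (c α) ⟩
      0ℚ                          ≡⟨ sym (trans (ℚ.+-identityʳ (0ℚ ℚ.* cM)) (ℚ.*-zeroˡ cM)) ⟩
      0ℚ ℚ.* cM ℚ.+ 0ℚ            ∎

  independent : ∀ c → (∀ λ′ → λ′ ∈ L → combination c λ′ ≡ 0ℚ) → ∀ α → α ∈ L → c α ≡ 0ℚ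
  independent c c-kills α α∈L = vanishesBelow (suc (rank α)) α∈L ≤-refl
    where
    vanishesBelow : ∀ b {α} → α ∈ L → rank α < b → c α ≡ 0ℚ
    vanishesBelow (suc b) {α} α∈L (s≤s rα≤b) =
      *≡0⇒≡0 (M α α) (c α) (trans (ℚ.*-comm (M α α) (c α)) cM≡0) (M-diagonal α∈L)
      where
      lower≡0 : lowerPart c α ≡ 0ℚ
      lower≡0 = sumℚ-map-0 (lowerTerm c α) (All.tabulate lowerTerm≡0)
        where
        lowerTerm≡0 : ∀ {β} → β ∈ L → lowerTerm c α β ≡ 0ℚ
        lowerTerm≡0 {β} β∈L with rank β <ᵇ rank α | <ᵇ-reflects-< (rank β) (rank α)
        ... | true | ofʸ rβ<rα =
          trans (cong (ℚ._* M α β) (vanishesBelow b β∈L (<-≤-trans rβ<rα rα≤b))) (ℚ.*-zeroˡ (M α β))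
        ... | false | _ = refl
      cM≡0 : c α ℚ.* M α α ≡ 0ℚ
      cM≡0 = *≡0⇒≡0 (occurrences α) _ (begin
        diagonal                    ≡⟨ sym (ℚ.+-identityʳ _) ⟩
        diagonal ℚ.+ 0ℚ             ≡⟨ cong (diagonal ℚ.+_) (sym lower≡0) ⟩
        diagonal ℚ.+ lowerPart c α  ≡⟨ sym (combination-split c α) ⟩
        combination c α             ≡⟨ c-kills α α∈L ⟩
        0ℚ                          ∎) (occurrences≢0 α∈L)
        where
        open ≡-Reasoning
        diagonal : ℚ
        diagonal = occurrences α ℚ.* (c α ℚ.* M α α)

  module Solve (v : I → ℚ) where

    -- Forward substitution: approx b is already correct at every index of rank < b.
    approx : ℕ → I → ℚ
    approx zero _ = 0ℚ
    approx (suc b) λ′ = (v λ′ ℚ.- lowerPart (approx b) λ′) ℚ.* recip (occurrences λ′ ℚ.* M λ′ λ′)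

    approx-stable : ∀ b b′ {α} → rank α < b → rank α < b′ → approx b α ≡ approx b′ α
    approx-stable (suc b) (suc b′) {α} (s≤s rα≤b) (s≤s rα≤b′) =
      cong (λ r → (v α ℚ.- r) ℚ.* recip (occurrences α ℚ.* M α α))
           (cong sumℚ (map-cong sameTerm L))
      where
      sameTerm : ∀ β → lowerTerm (approx b) α β ≡ lowerTerm (approx b′) α β
      sameTerm β with rank β <ᵇ rank α | <ᵇ-reflects-< (rank β) (rank α)
      ... | true | ofʸ rβ<rα =
        cong (ℚ._* M α β) (approx-stable b b′ (<-≤-trans rβ<rα rα≤b) (<-≤-trans rβ<rα rα≤b′))
      ... | false | _ = refl

    solution : I → ℚ
    solution λ′ = approx (suc (rank λ′)) λ′

    solves : ∀ λ′ → λ′ ∈ L → combination solution λ′ ≡ v λ′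
    solves λ′ λ′∈L = begin
      combination solution λ′
        ≡⟨ combination-split solution λ′ ⟩
      occurrences λ′ ℚ.* (solution λ′ ℚ.* M λ′ λ′) ℚ.+ lowerPart solution λ′
        ≡⟨ cong (occurrences λ′ ℚ.* (solution λ′ ℚ.* M λ′ λ′) ℚ.+_) (cong sumℚ (map-cong lowerStable L)) ⟩
      d ℚ.* ((v λ′ ℚ.- R) ℚ.* recip (d ℚ.* m) ℚ.* m) ℚ.+ R
        ≡⟨ cong (ℚ._+ R) (rearrange d m (v λ′ ℚ.- R) (recip (d ℚ.* m))) ⟩
      (d ℚ.* m) ℚ.* recip (d ℚ.* m) ℚ.* (v λ′ ℚ.- R) ℚ.+ R
        ≡⟨ cong (λ z → z ℚ.* (v λ′ ℚ.- R) ℚ.+ R) (*-recip (d ℚ.* m) dm≢0) ⟩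
      1ℚ ℚ.* (v λ′ ℚ.- R) ℚ.+ R
        ≡⟨ cancel (v λ′) R ⟩
      v λ′ ∎
      where
      open ≡-Reasoning
      open Data.Rational.Solver.+-*-Solver
      d m R : ℚ
      d = occurrences λ′
      m = M λ′ λ′
      R = lowerPart (approx (rank λ′)) λ′
      dm≢0 : d ℚ.* m ≢ 0ℚ
      dm≢0 dm≡0 = M-diagonal λ′∈L (*≡0⇒≡0 d m dm≡0 (occurrences≢0 λ′∈L))
      lowerStable : ∀ β → lowerTerm solution λ′ β ≡ lowerTerm (approx (rank λ′)) λ′ β
      lowerStable β with rank β <ᵇ rank λ′ | <ᵇ-reflects-< (rank β) (rank λ′)
      ... | true | ofʸ rβ<rλ = cong (ℚ._* M λ′ β) (approx-stable (suc (rank β)) (rank λ′) ≤-refl rβ<rλ)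
      ... | false | _ = refl
      rearrange : ∀ d m x r → d ℚ.* (x ℚ.* r ℚ.* m) ≡ d ℚ.* m ℚ.* r ℚ.* x
      rearrange = solve 4 (λ d m x r → d :* (x :* r :* m) := d :* m :* r :* x) refl
      cancel : ∀ x r → 1ℚ ℚ.* (x ℚ.- r) ℚ.+ r ≡ x
      cancel = solve 2 (λ x r → con 1ℚ :* (x :- r) :+ r := x) refl

  spanning : ∀ v → ∃[ c ] (∀ λ′ → λ′ ∈ L → combination c λ′ ≡ v λ′)
  spanning v = Solve.solution v , Solve.solves v

coeff-++ : ∀ f g λ′ → coeff (f ++ g) λ′ ≡ coeff f λ′ ℚ.+ coeff g λ′
coeff-++ [] g λ′ = sym (ℚ.+-identityˡ _)
coeff-++ ((a , e) ∷ f) g λ′ with sortDesc e ==ᴸ λ′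
... | true = trans (cong (a ℚ.+_) (coeff-++ f g λ′)) (sym (ℚ.+-assoc a _ _))
... | false = coeff-++ f g λ′

coeff-scale : ∀ q f λ′ → coeff (scale q f) λ′ ≡ q ℚ.* coeff f λ′
coeff-scale q [] λ′ = sym (ℚ.*-zeroʳ q)
coeff-scale q ((a , e) ∷ f) λ′ with sortDesc e ==ᴸ λ′
... | true = trans (cong (q ℚ.* a ℚ.+_) (coeff-scale q f λ′)) (sym (ℚ.*-distribˡ-+ q a _))
... | false = coeff-scale q f λ′

coeff-lincomb : ∀ n c B λ′ → coeff (lincomb n c B) λ′ ≡ sumℚ (map (λ α → c α ℚ.* coeff (B α) λ′) (partitions n))
coeff-lincomb n c B λ′ = go (partitions n)
  where
  go : ∀ αs → coeff (sumS (map (λ α → scale (c α) (B α)) αs)) λ′ ≡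
              sumℚ (map (λ α → c α ℚ.* coeff (B α) λ′) αs)
  go [] = refl
  go (α ∷ αs) = trans (coeff-++ (scale (c α) (B α)) _ λ′) (cong₂ ℚ._+_ (coeff-scale (c α) (B α) λ′) (go αs))

coeff-0 : ∀ {f λ′} → All (λ t → sortDesc (proj₂ t) ≢ λ′) f → coeff f λ′ ≡ 0ℚ
coeff-0 [] = refl
coeff-0 {(a , e) ∷ f} {λ′} (e≢λ′ ∷ rest) with ≡-dec _≟_ (sortDesc e) λ′
... | yes e≡λ′ = contradiction e≡λ′ e≢λ′
... | no _ = coeff-0 rest

coeff-nonNeg : ∀ {f} λ′ → All (Positive ∘ proj₁) f → NonNegative (coeff f λ′)
coeff-nonNeg λ′ [] = _
coeff-nonNeg {(a , e) ∷ f} λ′ (a>0 ∷ rest) with ≡-dec _≟_ (sortDesc e) λ′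
... | yes _ = ℚ.nonNeg+nonNeg⇒nonNeg a {{ℚ.pos⇒nonNeg a {{a>0}}}} _ {{coeff-nonNeg λ′ rest}}
... | no _ = coeff-nonNeg λ′ rest

coeff-pos : ∀ {f λ′} → All (Positive ∘ proj₁) f → Any (λ t → sortDesc (proj₂ t) ≡ λ′) f →
            Positive (coeff f λ′)
coeff-pos {(a , e) ∷ f} {λ′} (a>0 ∷ rest) hit with ≡-dec _≟_ (sortDesc e) λ′ | hit
... | yes _ | _ = ℚ.pos+nonNeg⇒pos a {{a>0}} _ {{coeff-nonNeg λ′ rest}}
... | no e≢λ′ | here e≡λ′ = contradiction e≡λ′ e≢λ′
... | no _ | there hit′ = coeff-pos rest hit′

≤-+-tight : ∀ {a b c d} → a ≤ c → b ≤ d → c + d ≡ a + b → c ≡ a × d ≡ b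
≤-+-tight {a} {b} {c} {d} a≤c b≤d c+d≡a+b with m≤n⇒m<n∨m≡n a≤c
... | inj₁ a<c = contradiction (+-mono-<-≤ a<c b≤d) (<-irrefl (sym c+d≡a+b))
... | inj₂ refl = refl , +-cancelˡ-≡ a d b c+d≡a+b

-- The consequences of t refining α, up to order, that the triangularity argument uses.
record Finer (α t : List ℕ) : Set where
  field
    positive  : All (1 ≤_) t
    sum≡      : sum t ≡ sum α
    length≥   : length α ≤ length t
    length≡⇒↭ : length t ≡ length α → t ↭ α

finer-[] : Finer [] []
finer-[] = record { positive = [] ; sum≡ = refl ; length≥ = z≤n ; length≡⇒↭ = λ _ → ↭-refl }

finer-++ : ∀ {α β t u} → Finer α t → Finer β u → Finer (α ++ β) (t ++ u)
finer-++ {α} {β} {t} {u} t⊒α u⊒β = record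
  { positive  = All.++⁺ (positive t⊒α) (positive u⊒β)
  ; sum≡      = trans (sum-++ t u) (trans (cong₂ _+_ (sum≡ t⊒α) (sum≡ u⊒β)) (sym (sum-++ α β)))
  ; length≥   = subst₂ _≤_ (sym (length-++ α)) (sym (length-++ t)) (+-mono-≤ (length≥ t⊒α) (length≥ u⊒β))
  ; length≡⇒↭ = λ eq → let |t|≡|α| , |u|≡|β| = ≤-+-tight (length≥ t⊒α) (length≥ u⊒β)
                                                   (trans (sym (length-++ t)) (trans eq (length-++ α)))
                       in ++⁺ (length≡⇒↭ t⊒α |t|≡|α|) (length≡⇒↭ u⊒β |u|≡|β|)
  }
  where open Finer

finer-↭ : ∀ {α β t u} → α ↭ β → t ↭ u → Finer α t → Finer β u
finer-↭ α↭β t↭u t⊒α = record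
  { positive  = All-resp-↭ t↭u (positive t⊒α)
  ; sum≡      = trans (sym (sum-↭ t↭u)) (trans (sum≡ t⊒α) (sum-↭ α↭β))
  ; length≥   = subst₂ _≤_ (↭-length α↭β) (↭-length t↭u) (length≥ t⊒α)
  ; length≡⇒↭ = λ eq → ↭-trans (↭-sym t↭u) (↭-trans (length≡⇒↭ t⊒α
                  (trans (↭-length t↭u) (trans eq (sym (↭-length α↭β))))) α↭β)
  }
  where open Finer

finer-[_] : ∀ a {t} → All (1 ≤_) t → sum t ≡ a → 1 ≤ length t → Finer [ a ] t
finer-[ a ] {t} t>0 sum≡a 1≤|t| = record
  { positive  = t>0
  ; sum≡      = trans sum≡a (sym (+-identityʳ a))
  ; length≥   = 1≤|t|
  ; length≡⇒↭ = singleton t sum≡a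
  }
  where
  singleton : ∀ t → sum t ≡ a → length t ≡ 1 → t ↭ [ a ]
  singleton (x ∷ []) x+0≡a _ rewrite +-identityʳ x | x+0≡a = ↭-refl

record Triangular (α : List ℕ) (f : SymF) : Set where
  field
    terms   : All (λ t → Positive (proj₁ t) × Finer α (proj₂ t)) f
    leading : Any (λ t → proj₂ t ↭ α) f

triangular-↭ : ∀ {α β f} → α ↭ β → Triangular α f → Triangular β f
triangular-↭ α↭β tri = record
  { terms   = All.map (λ (t>0 , t⊒α) → t>0 , finer-↭ α↭β ↭-refl t⊒α) (Triangular.terms tri)
  ; leading = Any.map (λ t↭α → ↭-trans t↭α α↭β) (Triangular.leading tri)
  }

triangular-⊗ : ∀ {α β f g} → Triangular α f → Triangular β g → Triangular (α ++ β) (f ⊗ g)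
triangular-⊗ tri₁ tri₂ = record
  { terms   = All.concat⁺ (All.map⁺ (All.map (λ {s} s-ok → All.map⁺ (All.map (λ {t} → both {s = s} {t} s-ok) (terms tri₂)))
                                             (terms tri₁)))
  ; leading = Any.concat⁺ (Any.map⁺ (Any.map (λ s↭ → Any.map⁺ (Any.map (++⁺ s↭) (leading tri₂))) (leading tri₁)))
  }
  where
  open Triangular
  both : ∀ {α β} {s t : ℚ × List ℕ} →
         Positive (proj₁ s) × Finer α (proj₂ s) → Positive (proj₁ t) × Finer β (proj₂ t) →
         Positive (proj₁ s ℚ.* proj₁ t) × Finer (α ++ β) (proj₂ s ++ proj₂ t)
  both {s = s} {t} (s>0 , s⊒α) (t>0 , t⊒β) = ℚ.pos*pos⇒pos (proj₁ s) {{s>0}} (proj₁ t) {{t>0}} , finer-++ s⊒α t⊒β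

triangular-prodS : ∀ {A : Set} (G : A → List ℕ) (F : A → SymF) xs →
                   All (λ x → Triangular (G x) (F x)) xs → Triangular (concatMap G xs) (prodS (map F xs))
triangular-prodS G F [] [] = record { terms = (_ , finer-[]) ∷ [] ; leading = here ↭-refl }
triangular-prodS G F (x ∷ xs) (tri ∷ tris) = triangular-⊗ tri (triangular-prodS G F xs tris)

↭⇒sortDesc≡ : ∀ {n α t} → IsPartition n α → t ↭ α → sortDesc t ≡ α
↭⇒sortDesc≡ {t = t} α⊢n t↭α =
  sorted-↭⇒≡ (sortDesc-sorted t) (IsPartition.sorted α⊢n) (↭-trans (sortDesc-↭ t) t↭α)

finer⇒partition : ∀ {n α t} → IsPartition n α → Finer α t → IsPartition n (sortDesc t)
finer⇒partition {t = t} α⊢n t⊒α = mkPartition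
  (sortDesc-sorted t)
  (All-resp-↭ (↭-sym (sortDesc-↭ t)) (Finer.positive t⊒α))
  (trans (sum-↭ (sortDesc-↭ t)) (trans (Finer.sum≡ t⊒α) (IsPartition.sum≡ α⊢n)))

finer⇒equal-or-longer : ∀ {n α t} → IsPartition n α → Finer α t → sortDesc t ≡ α ⊎ length α < length (sortDesc t)
finer⇒equal-or-longer {α = α} {t} α⊢n t⊒α
  rewrite ↭-length (sortDesc-↭ t) with m≤n⇒m<n∨m≡n (Finer.length≥ t⊒α)
... | inj₁ |α|<|t| = inj₂ |α|<|t|
... | inj₂ |α|≡|t| = inj₁ (↭⇒sortDesc≡ α⊢n (Finer.length≡⇒↭ t⊒α (sym |α|≡|t|)))

triangular⇒basis : ∀ n B → (∀ α → α ∈ partitions n → Triangular α (B α)) → IsBasisΛ n B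
triangular⇒basis n B tri = record
  { inDegree = λ α α∈ → All.map (λ {t} (_ , t⊒α) → partitions-complete
                                     (finer⇒partition {t = proj₂ t} (partitions-sound {n} α∈) t⊒α))
                                (Triangular.terms (tri α α∈))
  ; spans    = λ v → let c , solves = spanning v
                     in c , λ λ′ λ′∈ → trans (coeff-lincomb n c B λ′) (solves λ′ λ′∈)
  ; indep    = λ c kills → independent c (λ λ′ λ′∈ → trans (sym (coeff-lincomb n c B λ′)) (kills λ′ λ′∈))
  }
  where
  M : List ℕ → List ℕ → ℚ
  M λ′ α = coeff (B α) λ′

  M-lower : ∀ {λ′ α} → α ∈ partitions n → λ′ ≢ α → length λ′ ≤ length α → M λ′ α ≡ 0ℚ
  M-lower {λ′} {α} α∈ λ′≢α |λ′|≤|α| =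
    coeff-0 (All.map (λ {t} → shape≢λ′ {proj₂ t} ∘ proj₂) (Triangular.terms (tri α α∈)))
    where
    shape≢λ′ : ∀ {t} → Finer α t → sortDesc t ≢ λ′
    shape≢λ′ t⊒α t≡λ′ with finer⇒equal-or-longer (partitions-sound {n} α∈) t⊒α
    ... | inj₁ t≡α = λ′≢α (trans (sym t≡λ′) t≡α)
    ... | inj₂ |α|<|t| = <⇒≱ (subst (λ s → length α < length s) t≡λ′ |α|<|t|) |λ′|≤|α|

  M-diagonal : ∀ {α} → α ∈ partitions n → M α α ≢ 0ℚ
  M-diagonal {α} α∈ = pos⇒≢0 (coeff-pos (All.map proj₁ (Triangular.terms (tri α α∈)))
                                        (Any.map (λ {t} → ↭⇒sortDesc≡ {t = proj₂ t} (partitions-sound {n} α∈))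
                                                 (Triangular.leading (tri α α∈))))

  open TriangularSystem (≡-dec _≟_) length (partitions n) M M-lower M-diagonal

inv-pos : ∀ n .{{_ : NonZero n}} → Positive (inv n)
inv-pos (suc n) = ℚ.normalize-pos 1 (suc n)

zee≢0 : ∀ λ′ → NonZero (zee λ′)
zee≢0 λ′ = product≢0 (All.map⁺ (All.applyUpTo⁺₂ suc (sum λ′) factor≢0))
  where
  factor≢0 : ∀ j → NonZero (suc j ^ mult (suc j) λ′ * mult (suc j) λ′ !)
  factor≢0 j = m*n≢0 (suc j ^ m) (m !) {{m^n≢0 (suc j) m}} {{m !≢0}}
    where
    m : ℕ
    m = mult (suc j) λ′

h-triangular : ∀ a → 1 ≤ a → Triangular [ a ] (h a)
h-triangular a 1≤a = record
  { terms   = All.concat⁺ (All.map⁺ (All.tabulate (λ {λ′} λ′∈ → term λ′ (partitions-sound {a} λ′∈) ∷ [])))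
  ; leading = Any.concat⁺ (Any.map⁺ (lose [a]∈ (here ↭-refl)))
  }
  where
  [a]∈ : [ a ] ∈ partitions a
  [a]∈ = partitions-complete (mkPartition [-] (1≤a ∷ []) (+-identityʳ a))
  term : ∀ λ′ → IsPartition a λ′ → Positive (inv (zee λ′) ℚ.* 1ℚ) × Finer [ a ] λ′
  term λ′ (mkPartition _ λ′>0 sum≡a) =
    ℚ.pos*pos⇒pos (inv (zee λ′)) {{inv-pos (zee λ′) {{zee≢0 λ′}}}} 1ℚ ,
    finer-[ a ] λ′>0 sum≡a (nonempty λ′ sum≡a)
    where
    nonempty : ∀ ℓ → sum ℓ ≡ a → 1 ≤ length ℓ
    nonempty [] refl = 1≤a
    nonempty (_ ∷ _) _ = s≤s z≤n

hα-triangular : ∀ α → All (1 ≤_) α → Triangular α (hα α)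
hα-triangular α α>0 =
  triangular-↭ (↭-reflexive (concatMap-pure α)) (triangular-prodS [_] h α (All.map (h-triangular _) α>0))

-- On a block of size a, σ_α^k acts as r ↦ (r + k) mod a, whose j-th iterate is rotate j.
-- It splits the block into d = gcd k a cycles of length L = a / d, with least elements 0, …, d - 1.
module PowerOfCycle (a′ k : ℕ) where

  open +-*-Solver

  a : ℕ
  a = suc a′

  d : ℕ
  d = gcd k a

  instance
    d≢0 : NonZero d
    d≢0 = ≢-nonZero (gcd[m,n]≢0 k a (inj₂ λ ()))

  L : ℕ
  L = a / d

  private
    d∣k : d ∣ k
    d∣k = gcd[m,n]∣m k a

    d∣a : d ∣ a
    d∣a = gcd[m,n]∣n k a

    k/d : ℕ
    k/d = k / d

    k/d*d≡k : k/d * d ≡ k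
    k/d*d≡k = m/n*n≡m d∣k

    k/d-coprime-L : Coprime k/d L
    k/d-coprime-L = coprime-/gcd k a

  L*d≡a : L * d ≡ a
  L*d≡a = m/n*n≡m d∣a

  instance
    L≢0 : NonZero L
    L≢0 = ≢-nonZero λ L≡0 → 1+n≢0 (trans (sym L*d≡a) (cong (_* d) L≡0))

  L≤a : L ≤ a
  L≤a = subst (L ≤_) L*d≡a (m≤m*n L d)

  d≤a : d ≤ a
  d≤a = subst (d ≤_) L*d≡a (m≤n*m d L)

  a∣jk⇔L∣j : ∀ j → a ∣ j * k ⇔ L ∣ j
  a∣jk⇔L∣j j = mk⇔ to from
    where
    to : a ∣ j * k → L ∣ j
    to a∣jk = coprime-divisor (Coprimality.sym k/d-coprime-L) (*-cancelʳ-∣ d (subst₂ _∣_ (sym L*d≡a) jk≡ a∣jk))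
      where
      jk≡ : j * k ≡ k/d * j * d
      jk≡ = trans (cong (j *_) (sym k/d*d≡k)) (solve 3 (λ j k/d d → j :* (k/d :* d) := k/d :* j :* d) refl j k/d d)
    from : L ∣ j → a ∣ j * k
    from (divides q refl) = divides (q * k/d) (begin
      q * L * k          ≡⟨ cong (q * L *_) (sym k/d*d≡k) ⟩
      q * L * (k/d * d)  ≡⟨ solve 4 (λ q L k/d d → q :* L :* (k/d :* d) := q :* k/d :* (L :* d)) refl q L k/d d ⟩
      q * k/d * (L * d)  ≡⟨ cong (q * k/d *_) L*d≡a ⟩
      q * k/d * a        ∎)
      where open ≡-Reasoning

  rotate : ℕ → ℕ → ℕ
  rotate j r = (r + j * k) % a

  rotate≡⇔L∣ : ∀ j {r} → r < a → rotate j r ≡ r ⇔ L ∣ j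
  rotate≡⇔L∣ j {r} r<a = mk⇔ to from
    where
    to : rotate j r ≡ r → L ∣ j
    to fixed = Equivalence.to (a∣jk⇔L∣j j) (divides ((r + j * k) / a) (+-cancelˡ-≡ r _ _
      (trans (m≡m%n+[m/n]*n (r + j * k) a) (cong (_+ (r + j * k) / a * a) fixed))))
    from : L ∣ j → rotate j r ≡ r
    from L∣j = trans (%-remove-+ʳ r (Equivalence.from (a∣jk⇔L∣j j) L∣j)) (m<n⇒m%n≡m r<a)

  rotate-%d : ∀ j r → rotate j r % d ≡ r % d
  rotate-%d j r = trans (m∣n⇒o%n%m≡o%m d a (r + j * k) d∣a) (%-remove-+ʳ r (∣n⇒∣m*n j d∣k))

  rotate-≥ : ∀ j {r} → r < d → r ≤ rotate j r
  rotate-≥ j {r} r<d = subst (_≤ rotate j r) (trans (rotate-%d j r) (m<n⇒m%n≡m r<d)) (m%n≤m (rotate j r) d)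

  rotate-%a : ∀ j r → rotate (j % a) r ≡ rotate j r
  rotate-%a j r = begin
    (r + j % a * k) % a                  ≡⟨ sym ([m+kn]%n≡m%n (r + j % a * k) (j / a * k) a) ⟩
    (r + j % a * k + j / a * k * a) % a  ≡⟨ cong (_% a) (regroup r (j % a) (j / a) k a) ⟩
    (r + (j % a + j / a * a) * k) % a    ≡⟨ cong (λ j′ → (r + j′ * k) % a) (sym (m≡m%n+[m/n]*n j a)) ⟩
    (r + j * k) % a                      ∎
    where
    open ≡-Reasoning
    regroup : ∀ r m q k a → r + m * k + q * k * a ≡ r + (m + q * a) * k
    regroup = solve 5 (λ r m q k a → r :+ m :* k :+ q :* k :* a := r :+ (m :+ q :* a) :* k) refl

  -- Bézout for gcd k a gives j with j * k ≡ - (r / d) * d (mod a).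
  rotate-reaches-%d : ∀ r → ∃[ j ] j < a × rotate j r ≡ r % d
  rotate-reaches-%d r = let j , q , r+jk≡ρ+qa = reach in j % a , m%n<n j a , landsAt j q r+jk≡ρ+qa
    where
    ρ t : ℕ
    ρ = r % d
    t = r / d
    r≡ρ+td : r ≡ ρ + t * d
    r≡ρ+td = m≡m%n+[m/n]*n r d
    reach : ∃[ j ] ∃[ q ] r + j * k ≡ ρ + q * a
    reach with Bézout.identity (gcd-GCD k a)
    ... | Bézout.-+ x y d+xk≡ya = t * x , t * y , (begin
      r + t * x * k          ≡⟨ cong (_+ t * x * k) r≡ρ+td ⟩
      ρ + t * d + t * x * k  ≡⟨ factor ρ t d x k ⟩
      ρ + t * (d + x * k)    ≡⟨ cong (λ z → ρ + t * z) d+xk≡ya ⟩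
      ρ + t * (y * a)        ≡⟨ cong (ρ +_) (sym (*-assoc t y a)) ⟩
      ρ + t * y * a          ∎)
      where
      open ≡-Reasoning
      factor : ∀ ρ t d x k → ρ + t * d + t * x * k ≡ ρ + t * (d + x * k)
      factor = solve 5 (λ ρ t d x k → ρ :+ t :* d :+ t :* x :* k := ρ :+ t :* (d :+ x :* k)) refl
    ... | Bézout.+- x y d+ya≡xk = t * x * a′ , t * d + t * a′ * y , (begin
      r + t * x * a′ * k               ≡⟨ cong (_+ t * x * a′ * k) r≡ρ+td ⟩
      ρ + t * d + t * x * a′ * k       ≡⟨ reorder ρ t d x a′ k ⟩
      ρ + t * d + t * a′ * (x * k)     ≡⟨ cong (λ z → ρ + t * d + t * a′ * z) (sym d+ya≡xk) ⟩
      ρ + t * d + t * a′ * (d + y * a) ≡⟨ factor ρ t d a′ y ⟩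
      ρ + (t * d + t * a′ * y) * a     ∎)
      where
      open ≡-Reasoning
      reorder : ∀ ρ t d x a′ k → ρ + t * d + t * x * a′ * k ≡ ρ + t * d + t * a′ * (x * k)
      reorder = solve 6 (λ ρ t d x a′ k → ρ :+ t :* d :+ t :* x :* a′ :* k := ρ :+ t :* d :+ t :* a′ :* (x :* k)) refl
      factor : ∀ ρ t d a′ y → ρ + t * d + t * a′ * (d + y * suc a′) ≡ ρ + (t * d + t * a′ * y) * suc a′
      factor = solve 5 (λ ρ t d a′ y → ρ :+ t :* d :+ t :* a′ :* (d :+ y :* (con 1 :+ a′))
                                      := ρ :+ (t :* d :+ t :* a′ :* y) :* (con 1 :+ a′)) refl
    landsAt : ∀ j q → r + j * k ≡ ρ + q * a → rotate (j % a) r ≡ ρ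
    landsAt j q r+jk≡ρ+qa = begin
      rotate (j % a) r  ≡⟨ rotate-%a j r ⟩
      (r + j * k) % a   ≡⟨ cong (_% a) r+jk≡ρ+qa ⟩
      (ρ + q * a) % a   ≡⟨ [m+kn]%n≡m%n ρ q a ⟩
      ρ % a             ≡⟨ m<n⇒m%n≡m (<-≤-trans (m%n<n r d) d≤a) ⟩
      ρ                 ∎
      where open ≡-Reasoning

  rotate-descends : ∀ {r} → d ≤ r → ∃[ j ] j < a × rotate j r < r
  rotate-descends {r} d≤r =
    let j , j<a , r↦r%d = rotate-reaches-%d r
    in j , j<a , subst (_< r) (sym r↦r%d) (<-≤-trans (m%n<n r d) d≤r)

cycleTypeOfPower : ℕ → ℕ → List ℕ
cycleTypeOfPower k zero = []
cycleTypeOfPower k (suc a′) = replicate d L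
  where open PowerOfCycle a′ k

finer-cycleTypeOfPower : ∀ k a → 1 ≤ a → Finer [ a ] (cycleTypeOfPower k a)
finer-cycleTypeOfPower k (suc a′) _ = finer-[ suc a′ ]
  (All.replicate⁺ d (>-nonZero⁻¹ L))
  (trans (sum-replicate d L) (trans (*-comm d L) L*d≡a))
  (subst (1 ≤_) (sym (length-replicate d)) (>-nonZero⁻¹ d))
  where open PowerOfCycle a′ k

finer-powers : ∀ k {α} → All (1 ≤_) α → Finer α (concatMap (cycleTypeOfPower k) α)
finer-powers k [] = finer-[]
finer-powers k {a ∷ α} (1≤a ∷ α>0) = finer-++ (finer-cycleTypeOfPower k a 1≤a) (finer-powers k α>0)

cycleTypeOfPower-coprime : ∀ k a′ → gcd k (suc a′) ≡ 1 → cycleTypeOfPower k (suc a′) ≡ [ suc a′ ]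
cycleTypeOfPower-coprime k a′ d≡1 = cong₂ replicate d≡1 (trans (/-congʳ d≡1) (n/1≡n (suc a′)))
  where open PowerOfCycle a′ k

concatMap-cycleTypeOfPower-coprime : ∀ k {α} → All (λ a → 1 ≤ a × gcd k a ≡ 1) α →
                                     concatMap (cycleTypeOfPower k) α ≡ α
concatMap-cycleTypeOfPower-coprime k [] = refl
concatMap-cycleTypeOfPower-coprime k {suc a′ ∷ α} ((_ , coprime) ∷ rest) =
  cong₂ _++_ (cycleTypeOfPower-coprime k a′ coprime) (concatMap-cycleTypeOfPower-coprime k rest)

suc[m%n]%n≡suc[m]%n : ∀ m n .{{_ : NonZero n}} → suc (m % n) % n ≡ suc m % n
suc[m%n]%n≡suc[m]%n m n = begin
  (1 + m % n) % n              ≡⟨ %-distribˡ-+ 1 (m % n) n ⟩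
  (1 % n + m % n % n) % n      ≡⟨ cong (λ z → (1 % n + z) % n) (m%n%n≡m%n m n) ⟩
  (1 % n + m % n) % n          ≡⟨ sym (%-distribˡ-+ 1 m n) ⟩
  (1 + m) % n                  ∎
  where open ≡-Reasoning

sigmaFrom-block : ∀ s a′ β {r} → r < suc a′ → sigmaFrom s (suc a′ ∷ β) (s + r) ≡ s + suc r % suc a′
sigmaFrom-block s a′ β {r} r<a
  with s ≤ᵇ s + r | ≤ᵇ-reflects-≤ s (s + r) | s + r <ᵇ s + suc a′ | <ᵇ-reflects-< (s + r) (s + suc a′)
... | false | ofⁿ s≰s+r | _ | _ = contradiction (m≤m+n s r) s≰s+r
... | true | _ | false | ofⁿ ¬s+r<s+a = contradiction (+-monoʳ-< s r<a) ¬s+r<s+a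
... | true | _ | true | _ with suc (s + r) <ᵇ s + suc a′ | <ᵇ-reflects-< (suc (s + r)) (s + suc a′)
...   | true | ofʸ 1+s+r<s+a = trans (sym (+-suc s r)) (cong (s +_) (sym (m<n⇒m%n≡m
                                 (+-cancelˡ-< s _ _ (subst (_< s + suc a′) (sym (+-suc s r)) 1+s+r<s+a)))))
...   | false | ofⁿ ¬1+s+r<s+a = trans (sym (+-identityʳ s))
                                   (cong (s +_) (sym (trans (%-congˡ {o = suc a′} r+1≡a) (n%n≡0 (suc a′)))))
  where
  r+1≡a : suc r ≡ suc a′
  r+1≡a = ≤-antisym r<a (≮⇒≥ (λ 1+r<a → ¬1+s+r<s+a (subst (_< s + suc a′) (+-suc s r) (+-monoʳ-< s 1+r<a))))

sigmaFrom-beyond : ∀ s a β {x} → s + a ≤ x → sigmaFrom s (a ∷ β) x ≡ sigmaFrom (s + a) β x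
sigmaFrom-beyond s a β {x} s+a≤x with x <ᵇ s + a | <ᵇ-reflects-< x (s + a)
... | true | ofʸ x<s+a = contradiction s+a≤x (<⇒≱ x<s+a)
... | false | _ with s ≤ᵇ x
...   | true = refl
...   | false = refl

sigmaFrom-++ : ∀ s γ β {x} → s + sum γ ≤ x → sigmaFrom s (γ ++ β) x ≡ sigmaFrom (s + sum γ) β x
sigmaFrom-++ s [] β {x} _ = cong (λ t → sigmaFrom t β x) (sym (+-identityʳ s))
sigmaFrom-++ s (b ∷ γ) β {x} s+b+γ≤x = begin
  sigmaFrom s (b ∷ γ ++ β) x       ≡⟨ sigmaFrom-beyond s b (γ ++ β) (≤-trans (m≤m+n (s + b) (sum γ)) s+b+γ≤x′) ⟩
  sigmaFrom (s + b) (γ ++ β) x     ≡⟨ sigmaFrom-++ (s + b) γ β s+b+γ≤x′ ⟩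
  sigmaFrom (s + b + sum γ) β x    ≡⟨ cong (λ t → sigmaFrom t β x) (+-assoc s b (sum γ)) ⟩
  sigmaFrom (s + (b + sum γ)) β x  ∎
  where
  open ≡-Reasoning
  s+b+γ≤x′ : s + b + sum γ ≤ x
  s+b+γ≤x′ = subst (_≤ x) (sym (+-assoc s b (sum γ))) s+b+γ≤x

module CycleStructure (α : List ℕ) where

  N : ℕ
  N = sum α

  σ : ℕ → ℕ
  σ = sigma α

  -- α = γ ++ a ∷ β: the block of a consists of the points sum γ, …, sum γ + a - 1.
  module Block (γ : List ℕ) (a′ : ℕ) (β : List ℕ) (split : γ ++ suc a′ ∷ β ≡ α) where

    s a : ℕ
    s = sum γ
    a = suc a′

    block-in-range : s + a ≤ N
    block-in-range = subst (s + a ≤_) (trans (sym (sum-++ γ (a ∷ β))) (cong sum split))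
                           (+-monoʳ-≤ s (m≤m+n a (sum β)))

    σ-on-block : ∀ {r} → r < a → σ (s + r) ≡ s + suc r % a
    σ-on-block {r} r<a = begin
      sigma α (s + r)                       ≡⟨ cong (λ α′ → sigma α′ (s + r)) (sym split) ⟩
      sigmaFrom 0 (γ ++ a ∷ β) (s + r)      ≡⟨ sigmaFrom-++ 0 γ (a ∷ β) (m≤m+n s r) ⟩
      sigmaFrom s (a ∷ β) (s + r)           ≡⟨ sigmaFrom-block s a′ β r<a ⟩
      s + suc r % a                         ∎
      where open ≡-Reasoning

    iter-σ-on-block : ∀ j {r} → r < a → iter σ j (s + r) ≡ s + (r + j) % a
    iter-σ-on-block zero {r} r<a = cong (s +_) (sym (trans (%-congˡ {o = a} (+-identityʳ r)) (m<n⇒m%n≡m r<a)))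
    iter-σ-on-block (suc j) {r} r<a = begin
      σ (iter σ j (s + r))       ≡⟨ cong σ (iter-σ-on-block j r<a) ⟩
      σ (s + (r + j) % a)        ≡⟨ σ-on-block (m%n<n (r + j) a) ⟩
      s + suc ((r + j) % a) % a  ≡⟨ cong (s +_) (trans (suc[m%n]%n≡suc[m]%n (r + j) a) (%-congˡ {o = a} (sym (+-suc r j)))) ⟩
      s + (r + suc j) % a        ∎
      where open ≡-Reasoning

    module Power (k : ℕ) where

      open PowerOfCycle a′ k hiding (a)

      g : ℕ → ℕ
      g = iter σ k

      g-on-block : ∀ j {r} → r < a → iter g j (s + r) ≡ s + rotate j r
      g-on-block j {r} r<a = trans (iter-iter σ k j (s + r)) (iter-σ-on-block (j * k) r<a)

      returns⇔ : ∀ j {r} → r < a → T (iter g j (s + r) ≡ᵇ s + r) ⇔ L ∣ j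
      returns⇔ j {r} r<a = mk⇔
        (λ t → Equivalence.to (rotate≡⇔L∣ j r<a)
                 (+-cancelˡ-≡ s _ _ (trans (sym (g-on-block j r<a)) (≡ᵇ⇒≡ _ _ t))))
        (λ L∣j → ≡⇒≡ᵇ _ _ (trans (g-on-block j r<a) (cong (s +_) (Equivalence.from (rotate≡⇔L∣ j r<a) L∣j))))

      orbitLen-block : ∀ {r} → r < a → orbitLen g N (s + r) ≡ L
      orbitLen-block {r} r<a =
        trans (firstᵇ-applyUpTo (λ j → iter g j (s + r) ≡ᵇ s + r) suc notYet back L′<N) L′+1≡L
        where
        L′ : ℕ
        L′ = pred L
        L′+1≡L : suc L′ ≡ L
        L′+1≡L = suc-pred L
        L′<N : L′ < N
        L′<N = ≤-trans (≤-reflexive L′+1≡L) (≤-trans L≤a (≤-trans (m≤n+m a s) block-in-range))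
        back : T (iter g (suc L′) (s + r) ≡ᵇ s + r)
        back = Equivalence.from (returns⇔ (suc L′) r<a) (subst (L ∣_) (sym L′+1≡L) ∣-refl)
        notYet : ∀ i → i < L′ → ¬ T (iter g (suc i) (s + r) ≡ᵇ s + r)
        notYet i i<L′ returns = <⇒≱ (subst (suc i <_) L′+1≡L (s≤s i<L′))
                                    (∣⇒≤ (Equivalence.to (returns⇔ (suc i) r<a) returns))

      isCycleMin-block : ∀ {r} → r < d → T (isCycleMin g N (s + r))
      isCycleMin-block {r} r<d = Equivalence.from (T-allᵇ _ (upTo N)) (All.applyUpTo⁺₂ _ N stays-above)
        where
        stays-above : ∀ j → T (s + r ≤ᵇ iter g j (s + r))
        stays-above j = ≤⇒≤ᵇ (subst (s + r ≤_) (sym (g-on-block j (<-≤-trans r<d d≤a))) (+-monoʳ-≤ s (rotate-≥ j r<d)))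

      ¬isCycleMin-block : ∀ {r} → d ≤ r → r < a → ¬ T (isCycleMin g N (s + r))
      ¬isCycleMin-block {r} d≤r r<a isMin =
        let j , j<a , descends = rotate-descends d≤r
            stays : T (s + r ≤ᵇ iter g j (s + r))
            stays = All.applyUpTo⁻ _ N (Equivalence.to (T-allᵇ _ (upTo N)) isMin)
                                   (<-≤-trans j<a (≤-trans (m≤n+m a s) block-in-range))
        in <⇒≱ descends (+-cancelˡ-≤ s _ _ (subst (s + r ≤_) (g-on-block j r<a) (≤ᵇ⇒≤ _ _ stays)))

      cycles-of-block : map (orbitLen g N) (filterᵇ (isCycleMin g N) (applyUpTo (s +_) a)) ≡ replicate d L
      cycles-of-block = begin
        map (orbitLen g N) (filterᵇ (isCycleMin g N) (applyUpTo (s +_) a))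
          ≡⟨ cong (map (orbitLen g N)) (filterᵇ-applyUpTo-prefix _ (s +_) d≤a isCycleMin-block ¬isCycleMin-block) ⟩
        map (orbitLen g N) (applyUpTo (s +_) d)
          ≡⟨ map-constant (orbitLen g N) (All.applyUpTo⁺₁ (s +_) d (λ r<d → orbitLen-block (<-≤-trans r<d d≤a))) ⟩
        replicate (length (applyUpTo (s +_) d)) L
          ≡⟨ cong (λ n → replicate n L) (length-applyUpTo (s +_) d) ⟩
        replicate d L ∎
        where open ≡-Reasoning

  private
    sum-snoc : ∀ γ b → sum (γ ++ [ b ]) ≡ sum γ + b
    sum-snoc γ b = trans (sum-++ γ [ b ]) (cong (sum γ +_) (+-identityʳ b))

    points-split : ∀ γ b β → applyUpTo (sum γ +_) (b + sum β) ≡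
                             applyUpTo (sum γ +_) b ++ applyUpTo (sum (γ ++ [ b ]) +_) (sum β)
    points-split γ b β = trans (applyUpTo-++ (sum γ +_) b (sum β)) (cong (applyUpTo (sum γ +_) b ++_)
      (applyUpTo-cong (λ i → trans (sym (+-assoc (sum γ) b i)) (cong (_+ i) (sym (sum-snoc γ b)))) (sum β)))

    split-step : ∀ {γ b β} → γ ++ b ∷ β ≡ α → (γ ++ [ b ]) ++ β ≡ α
    split-step {γ} {b} {β} split = trans (++-assoc γ [ b ] β) split

  all-points : ∀ {P : ℕ → Set} → (∀ γ a′ β → γ ++ suc a′ ∷ β ≡ α → ∀ {r} → r < suc a′ → P (sum γ + r)) →
               All P (upTo N)
  all-points {P} on-block = from [] α refl
    where
    from : ∀ γ β → γ ++ β ≡ α → All P (applyUpTo (sum γ +_) (sum β))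
    from γ [] _ = []
    from γ (b ∷ β) split = subst (All P) (sym (points-split γ b β))
      (All.++⁺ (block b split) (from (γ ++ [ b ]) β (split-step split)))
      where
      block : ∀ b → γ ++ b ∷ β ≡ α → All P (applyUpTo (sum γ +_) b)
      block zero _ = []
      block (suc a′) split = All.applyUpTo⁺₁ (sum γ +_) (suc a′) (on-block γ a′ β split)

  cycleType-iter-σ : ∀ k → cycleType (iter σ k) N ≡ sortDesc (concatMap (cycleTypeOfPower k) α)
  cycleType-iter-σ k = cong sortDesc (from [] α refl)
    where
    g : ℕ → ℕ
    g = iter σ k
    lengthsAtMinima : List ℕ → List ℕ
    lengthsAtMinima xs = map (orbitLen g N) (filterᵇ (isCycleMin g N) xs)
    lengthsAtMinima-++ : ∀ xs ys → lengthsAtMinima (xs ++ ys) ≡ lengthsAtMinima xs ++ lengthsAtMinima ys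
    lengthsAtMinima-++ xs ys = trans (cong (map (orbitLen g N)) (filterᵇ-++ (isCycleMin g N) xs ys))
                                     (map-++ (orbitLen g N) (filterᵇ (isCycleMin g N) xs) (filterᵇ (isCycleMin g N) ys))
    from : ∀ γ β → γ ++ β ≡ α → lengthsAtMinima (applyUpTo (sum γ +_) (sum β)) ≡ concatMap (cycleTypeOfPower k) β
    from γ [] _ = refl
    from γ (b ∷ β) split = begin
      lengthsAtMinima (applyUpTo (sum γ +_) (b + sum β))
        ≡⟨ cong lengthsAtMinima (points-split γ b β) ⟩
      lengthsAtMinima (applyUpTo (sum γ +_) b ++ applyUpTo (sum (γ ++ [ b ]) +_) (sum β))
        ≡⟨ lengthsAtMinima-++ (applyUpTo (sum γ +_) b) _ ⟩
      lengthsAtMinima (applyUpTo (sum γ +_) b) ++ lengthsAtMinima (applyUpTo (sum (γ ++ [ b ]) +_) (sum β))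
        ≡⟨ cong₂ _++_ (block b split) (from (γ ++ [ b ]) β (split-step split)) ⟩
      cycleTypeOfPower k b ++ concatMap (cycleTypeOfPower k) β ∎
      where
      open ≡-Reasoning
      block : ∀ b → γ ++ b ∷ β ≡ α → lengthsAtMinima (applyUpTo (sum γ +_) b) ≡ cycleTypeOfPower k b
      block zero _ = refl
      block (suc a′) split = Block.Power.cycles-of-block γ a′ β split k

  all-parts : ∀ {Q : ℕ → Set} → (∀ γ b β → γ ++ b ∷ β ≡ α → Q b) → All Q α
  all-parts {Q} at = from [] α refl
    where
    from : ∀ γ β → γ ++ β ≡ α → All Q β
    from γ [] _ = []
    from γ (b ∷ β) split = at γ b β split ∷ from (γ ++ [ b ]) β (split-step split)

  private
    fixes : ℕ → Bool
    fixes k = allᵇ (λ x → iter σ k x ≡ᵇ x) (upTo N)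

  fixes-N! : T (fixes (N !))
  fixes-N! = Equivalence.from (T-allᵇ _ (upTo N)) (all-points on-block)
    where
    on-block : ∀ γ a′ β → γ ++ suc a′ ∷ β ≡ α → ∀ {r} → r < suc a′ →
               T (iter σ (N !) (sum γ + r) ≡ᵇ sum γ + r)
    on-block γ a′ β split {r} r<a = ≡⇒≡ᵇ _ _ (trans (iter-σ-on-block (N !) r<a)
      (cong (sum γ +_) (trans (%-remove-+ʳ r a∣N!) (m<n⇒m%n≡m r<a))))
      where
      open Block γ a′ β split
      a∣N! : suc a′ ∣ N !
      a∣N! = ∣-trans (m∣m*n (a′ !)) (m≤n⇒m!∣n! (≤-trans (m≤n+m a s) block-in-range))

  order-found : order σ N ∈ applyUpTo suc (N !) × T (fixes (order σ N))
  order-found = firstᵇ-found fixes (Any.applyUpTo⁺ suc (subst (T ∘ fixes) (sym (suc-pred (N !) {{N !≢0}})) fixes-N!)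
                                                        (≤-reflexive (suc-pred (N !) {{N !≢0}})))

  1≤order : 1 ≤ order σ N
  1≤order with _ , _ , eq ← ∈-applyUpTo⁻ suc (proj₁ order-found) = subst (1 ≤_) (sym eq) (s≤s z≤n)

  order≡1⇒parts≤1 : order σ N ≡ 1 → All (_≤ 1) α
  order≡1⇒parts≤1 o≡1 = all-parts part≤1
    where
    σ-fixes : All (λ x → T (iter σ 1 x ≡ᵇ x)) (upTo N)
    σ-fixes = Equivalence.to (T-allᵇ _ (upTo N)) (subst (T ∘ fixes) o≡1 (proj₂ order-found))
    part≤1 : ∀ γ b β → γ ++ b ∷ β ≡ α → b ≤ 1
    part≤1 γ zero β _ = z≤n
    part≤1 γ (suc a′) β split = a≤1 a′ (+-cancelˡ-≡ s _ _ (trans (sym (σ-on-block z<s)) (≡ᵇ⇒≡ _ _ σ-fixes-s)))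
      where
      open Block γ a′ β split
      σ-fixes-s : T (iter σ 1 (s + 0) ≡ᵇ s + 0)
      σ-fixes-s = All.applyUpTo⁻ id N σ-fixes (≤-trans (+-monoʳ-< s z<s) block-in-range)
      a≤1 : ∀ a′ → 1 % suc a′ ≡ 0 → suc a′ ≤ 1
      a≤1 zero _ = ≤-refl

module _ (α : List ℕ) (α>0 : All (1 ≤_) α) where

  open CycleStructure α

  -- σ_α itself has cycle type α, unless σ_α = id, in which case σ_α⁰ will do.
  leading-power : ∃[ k ] k < order σ N × concatMap (cycleTypeOfPower k) α ≡ α
  leading-power with m≤n⇒m<n∨m≡n 1≤order
  ... | inj₁ 1<o = 1 , 1<o , concatMap-cycleTypeOfPower-coprime 1 (All.map (λ {a} 1≤a → 1≤a , gcd-zeroˡ a) α>0)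
  ... | inj₂ 1≡o = 0 , 1≤order , concatMap-cycleTypeOfPower-coprime 0
    (All.zipWith (λ {a} (1≤a , a≤1) → 1≤a , trans (gcd-identityˡ a) (≤-antisym a≤1 1≤a))
                 (α>0 , order≡1⇒parts≤1 (sym 1≡o)))

  finer-cycleType : ∀ k → Finer α (cycleType (iter σ k) N)
  finer-cycleType k = subst (Finer α) (sym (cycleType-iter-σ k)) (finer-↭ ↭-refl (↭-sym (sortDesc-↭ _)) (finer-powers k α>0))

  C-triangular : Triangular α (C α)
  C-triangular = record
    { terms   = All.map⁺ (All.concat⁺ (All.map⁺ (All.applyUpTo⁺₂ id (order σ N)
                                                   (λ k → (coefficient>0 , finer-cycleType k) ∷ []))))
    ; leading = Any.map⁺ (Any.concat⁺ (Any.map⁺ (Any.applyUpTo⁺ id (here leads) k<o)))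
    }
    where
    coefficient>0 : Positive (inv (order σ N) ℚ.* 1ℚ)
    coefficient>0 = ℚ.pos*pos⇒pos (inv (order σ N)) {{inv-pos (order σ N) {{>-nonZero 1≤order}}}} 1ℚ
    k : ℕ
    k = proj₁ leading-power
    k<o : k < order σ N
    k<o = proj₁ (proj₂ leading-power)
    leads : cycleType (iter σ k) N ↭ α
    leads = ↭-trans (↭-reflexive (cycleType-iter-σ k)) (↭-trans (sortDesc-↭ _) (↭-reflexive (proj₂ (proj₂ leading-power))))

module Groups (α : List ℕ) where

  group : ℕ → List ℕ
  group i = replicate (mult i α) i

  groups : ℕ → List ℕ
  groups M = concatMap group (applyUpTo suc M)

  mult-groups-suc : ∀ M j → mult j (groups (suc M)) ≡ mult j (groups M) + mult j (group (suc M))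
  mult-groups-suc M j = begin
    mult j (concatMap group (applyUpTo suc (suc M)))
      ≡⟨ cong (mult j ∘ concatMap group) (sym (applyUpTo-∷ʳ suc M)) ⟩
    mult j (concatMap group (applyUpTo suc M ++ [ suc M ]))
      ≡⟨ cong (mult j) (trans (concatMap-++ group (applyUpTo suc M) [ suc M ]) (cong (groups M ++_) (++-identityʳ _))) ⟩
    mult j (groups M ++ group (suc M))
      ≡⟨ mult-++ j (groups M) (group (suc M)) ⟩
    mult j (groups M) + mult j (group (suc M)) ∎
    where open ≡-Reasoning

  mult-groups-outside : ∀ M j → (∀ {i} → 1 ≤ i → i ≤ M → j ≢ i) → mult j (groups M) ≡ 0
  mult-groups-outside zero j _ = refl
  mult-groups-outside (suc M) j j∉ = begin
    mult j (groups (suc M))                    ≡⟨ mult-groups-suc M j ⟩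
    mult j (groups M) + mult j (group (suc M))
      ≡⟨ cong₂ _+_ (mult-groups-outside M j (λ 1≤i i≤M → j∉ 1≤i (m≤n⇒m≤1+n i≤M)))
                   (mult-replicate-other (mult (suc M) α) (j∉ z<s ≤-refl)) ⟩
    0                                          ∎
    where open ≡-Reasoning

  mult-groups-inside : ∀ M j → 1 ≤ j → j ≤ M → mult j (groups M) ≡ mult j α
  mult-groups-inside zero j 1≤j j≤0 = contradiction (≤-trans 1≤j j≤0) λ ()
  mult-groups-inside (suc M) j 1≤j j≤1+M with m≤n⇒m<n∨m≡n j≤1+M
  ... | inj₁ (s≤s j≤M) = begin
    mult j (groups (suc M))                    ≡⟨ mult-groups-suc M j ⟩
    mult j (groups M) + mult j (group (suc M)) ≡⟨ cong₂ _+_ (mult-groups-inside M j 1≤j j≤M)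
                                                          (mult-replicate-other (mult (suc M) α) (<⇒≢ (s≤s j≤M))) ⟩
    mult j α + 0                               ≡⟨ +-identityʳ _ ⟩
    mult j α                                   ∎
    where open ≡-Reasoning
  ... | inj₂ refl = begin
    mult j (groups (suc M))                    ≡⟨ mult-groups-suc M j ⟩
    mult j (groups M) + mult j (group j)
      ≡⟨ cong₂ _+_ (mult-groups-outside M j (λ {i} _ i≤M j≡i → <⇒≢ (s≤s i≤M) (sym j≡i)))
                   (mult-replicate-self (mult j α) j) ⟩
    mult j α                                   ∎
    where open ≡-Reasoning

  groups↭ : All (1 ≤_) α → groups (sum α) ↭ α
  groups↭ α>0 = mult-≡⇒↭ (groups (sum α)) same
    where
    same : ∀ j → mult j (groups (sum α)) ≡ mult j α
    same zero = trans (mult-groups-outside (sum α) 0 (λ {i} 1≤i _ → <⇒≢ 1≤i))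
                      (sym (mult-absent {0} (λ 0∈α → contradiction (All.lookup α>0 0∈α) λ ())))
    same (suc j) with suc j ≤? sum α
    ... | yes j<M = mult-groups-inside (sum α) (suc j) (s≤s z≤n) j<M
    ... | no j≮M = trans (mult-groups-outside (sum α) (suc j) (λ {i} _ i≤M j≡i → j≮M (subst (_≤ sum α) (sym j≡i) i≤M)))
                         (sym (mult-absent (λ j∈α → j≮M (All.lookup (parts≤sum α) j∈α))))

K-triangular : ∀ α → All (1 ≤_) α → Triangular α (K α)
K-triangular α α>0 = triangular-↭ (↭-trans (↭-reflexive present-groups) (groups↭ α>0))
  (triangular-prodS group (C ∘ group) present (All.map (λ {i} 1≤i → C-triangular (group i) (All.replicate⁺ _ 1≤i))
    (subst (All (1 ≤_)) (sym (filterᵇ≗filter nonEmpty (applyUpTo suc (sum α))))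
           (All.filter⁺ (T? ∘ nonEmpty) (All.applyUpTo⁺₂ suc (sum α) (λ _ → s≤s z≤n))))))
  where
  open Groups α
  nonEmpty : ℕ → Bool
  nonEmpty i = not (mult i α ≡ᵇ 0)
  present : List ℕ
  present = filterᵇ nonEmpty (applyUpTo suc (sum α))
  present-groups : concatMap group present ≡ groups (sum α)
  present-groups = concatMap-filterᵇ nonEmpty group (applyUpTo suc (sum α)) empty
    where
    empty : ∀ i → nonEmpty i ≡ false → group i ≡ []
    empty i isEmpty with mult i α | isEmpty
    ... | zero | _ = refl
    ... | suc _ | ()

mainTheorem1 : (n : ℕ) → IsBasisΛ n hα × IsBasisΛ n C × IsBasisΛ n K
mainTheorem1 n = triangular⇒basis n hα (λ α α∈ → hα-triangular α (positive α∈))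
               , triangular⇒basis n C (λ α α∈ → C-triangular α (positive α∈))
               , triangular⇒basis n K (λ α α∈ → K-triangular α (positive α∈))
  where
  positive : ∀ {α} → α ∈ partitions n → All (1 ≤_) α
  positive = IsPartition.positive ∘ partitions-sound {n}
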